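{- Let $p$ be a prime power such that $p-1$ is also a prime power, and set $r=2p-1$. Construct the hypergraph $\mathcal{G}_r$ as follows. Let $\mathcal{J}$ be the hypergraph obtained from the affine plane $\mathrm{AG}(2,p-1)$ by choosing one parallel class $B_1$, removing its lines from the edge set, and declaring those $p-1$ lines to be the vertex classes; so $\mathcal{J}$ is $(p-1)$-partite, $(p-1)$-uniform, and its edges form $p-1$ parallel classes (the remaining parallel classes of $\mathrm{AG}(2,p-1)$), each consisting of $p-1$ pairwise disjoint edges. Take $\mathcal{A}_p$ with vertex classes $V_1,\dots,V_{p+1}$ and edge classes $C_1,\dots,C_{p+1}$ (as in the context), and introduce $p-2$ further vertex classes $V_{p+2},\dots,V_{2p-1}$. For each $i=1,\dots,p+1$ take a copy $\mathcal{J}^i$ of $\mathcal{J}$ on new vertices, the copies being pairwise vertex-disjoint and disjoint from the vertex set of $\mathcal{A}_p$; the vertices of one vertex class of $\mathcal{J}^i$ are added to the class $V_i$, and the vertices of the remaining $p-2$ classes of $\mathcal{J}^i$ are added, one class to each, to $V_{p+2},\dots,V_{2p-1}$ (arbitrarily). For each $i$ fix an arbitrary bijection between the $p-1$ edges of $C_i$ and the $p-1$ parallel classes of $\mathcal{J}^i$, and for each $e\in C_i$ include in $\mathcal{G}_r$ the $p-1$ edges $e\cup f$, where $f$ ranges over the edges of the parallel class of $\mathcal{J}^i$ assigned to $e$. These are all the edges of $\mathcal{G}_r$. Then: (1) $\mathcal{G}_r$ is an $r$-partite $r$-uniform intersecting hypergraph (with respect to the enlarged classes $V_1,\dots,V_{2p-1}$);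 (2) $\tau(\mathcal{G}_r)\ge r-1$.
   Context: A hypergraph is $r$-partite if its vertex set has a partition into $r$ classes such that every edge contains at most one vertex of each class; it is $r$-uniform if every edge has exactly $r$ vertices; it is intersecting if every two edges share a vertex. $\tau(\mathcal{H})$ denotes the minimum size of a vertex cover (a set of vertices meeting every edge). For a prime power $q$, the affine plane $\mathrm{AG}(2,q)$ is obtained from the projective plane $\mathrm{PG}(2,q)$ of order $q$ by deleting one line and all its points; it has $q^2$ points, lines of size $q$, and $q+1$ parallel classes of $q$ pairwise disjoint lines, with lines from different parallel classes meeting in exactly one point. The hypergraph $\mathcal{A}_p$: fix a point $x$ of $\mathrm{AG}(2,p)$; the vertices of $\mathcal{A}_p$ are the points other than $x$, and its edges are the lines not containing $x$. If $L_1,\dots,L_{p+1}$ are the lines through $x$, then $V_i=L_i\setminus\{x\}$ (so $|V_i|=p-1$), and $C_i$ is the set of edges of $\mathcal{A}_p$ parallel to $L_i$; thus $C_i$ consists of $p-1$ pairwise disjoint $p$-element edges, each disjoint from $V_i$ and meeting each $V_j$, $j\ne i$, in exactly one vertex. -}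

module Defs where

open import Level using (0ℓ)
open import Data.Nat using (ℕ; _≤_; _^_; _∸_)
open import Data.Nat.Primality using (Prime)
open import Data.Fin using (Fin)
open import Data.Maybe using (Maybe; just; nothing; maybe)
open import Data.Maybe.Properties using () renaming (≡-dec to Maybe-≡-dec)
open import Data.Product using (Σ; ∃; ∃-syntax; _×_; _,_; proj₁; proj₂)
open import Data.Sum using (_⊎_; inj₁; inj₂)
open import Data.List using (List; length)
open import Data.List.Membership.Propositional using (_∈_)
open import Data.List.Relation.Unary.Unique.Propositional using (Unique)
open import Algebra.Core using (Op₁; Op₂)
open import Algebra.Structures using (IsCommutativeRing)
open import Function.Bundles using (_↔_; _⇔_; Inverse)
open import Relation.Nullary using (¬_; yes; no)
open import Relation.Nullary.Decidable using (False)
open import Relation.Binary.Definitions using (DecidableEquality)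
open import Relation.Binary.PropositionalEquality using (_≡_; refl; cong₂)

IsPrimePower : ℕ → Set
IsPrimePower n = ∃[ ℓ ] ∃[ k ] (Prime ℓ × 1 ≤ k × n ≡ ℓ ^ k)

record FiniteField (q : ℕ) : Set₁ where
  infixl 7 _*_
  infixl 6 _+_
  field
    Carrier : Set
    _≟_     : DecidableEquality Carrier
    _+_ _*_ : Op₂ Carrier
    -_      : Op₁ Carrier
    0# 1#   : Carrier
    _⁻¹     : Op₁ Carrier      -- value at 0# is irrelevant
    isCommutativeRing : IsCommutativeRing _≡_ _+_ _*_ -_ 0# 1#
    0≢1     : ¬ (0# ≡ 1#)
    ⁻¹-inverse : ∀ a → ¬ (a ≡ 0#) → a * (a ⁻¹) ≡ 1#
    card    : Fin q ↔ Carrier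

-- Lines: (direction , intercept), where direction
-- nothing = vertical line {(a,b) | a = c}, and direction just m is the
-- line {(a,b) | b = m·a + c}.  Parallel classes = directions.

module AG {q : ℕ} (F : FiniteField q) where
  open FiniteField F

  Point : Set
  Point = Carrier × Carrier

  Dir : Set
  Dir = Maybe Carrier

  Line : Set
  Line = Dir × Carrier

  _on_ : Point → Line → Set
  (a , b) on (nothing , c) = a ≡ c
  (a , b) on (just m  , c) = b ≡ m * a + c

  intercept : Dir → Point → Carrier
  intercept nothing  (a , b) = a
  intercept (just m) (a , b) = b + - (m * a)

  dirOf : Point → Point → Dir
  dirOf (a , b) (a′ , b′) with a ≟ a′
  ... | yes _ = nothing
  ... | no  _ = just ((b′ + - b) * ((a′ + - a) ⁻¹))

  _≟D_ : DecidableEquality Dir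
  _≟D_ = Maybe-≡-dec _≟_

  _≟P_ : DecidableEquality Point
  (a , b) ≟P (a′ , b′) with a ≟ a′ | b ≟ b′
  ... | yes refl | yes refl = yes refl
  ... | no  a≢   | _        = no λ { refl → a≢ refl }
  ... | yes _    | no b≢    = no λ { refl → b≢ refl }

record Hypergraph : Set₁ where
  field
    Vertex : Set
    Edge   : Set
    _∈ₑ_   : Vertex → Edge → Set

module _ (H : Hypergraph) where
  open Hypergraph H

  HasSize : (Vertex → Set) → ℕ → Set
  HasSize P k = Σ (List Vertex) λ l →
    Unique l × length l ≡ k × (∀ v → (v ∈ l) ⇔ P v)

  IsUniform : ℕ → Set
  IsUniform k = ∀ e → HasSize (_∈ₑ e) k

  IsPartiteWrt : {C : Set} → (Vertex → C) → Set
  IsPartiteWrt cls = ∀ e u v → u ∈ₑ e → v ∈ₑ e → cls u ≡ cls v → u ≡ v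

  IsIntersecting : Set
  IsIntersecting = ∀ e f → ∃[ v ] (v ∈ₑ e × v ∈ₑ f)

  IsCover : List Vertex → Set
  IsCover S = ∀ e → ∃[ v ] (v ∈ S × v ∈ₑ e)

  τ≥ : ℕ → Set
  τ≥ k = ∀ S → Unique S → IsCover S → k ≤ length S

-- F : field of order p (for AG(2,p)), K : field of order p-1 (AG(2,p-1)),
--   x : the removed point of AG(2,p),
--   d₁ : the direction of the parallel class B₁ of AG(2,p-1),
--   σ i : bijection between the vertex classes of 𝒥^i (= lines of B₁, indexed
--         by intercept) and {V_i} ∪ {V_{p+2},…,V_{2p-1}}
--         (nothing ↦ V_i, just k ↦ V_{p+2+k}),
--   τ i : bijection between the edges of C_i and the parallel classes of 𝒥^i.
-- The index i of V_1..V_{p+1}, C_1..C_{p+1}, 𝒥^1..𝒥^{p+1} ranges over the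
-- p+1 directions of AG(2,p) (= lines L_i through x).

module Construction {p : ℕ} (F : FiniteField p) (K : FiniteField (p ∸ 1)) where
  module AF = AG F
  module AK = AG K
  module FF = FiniteField F
  module FK = FiniteField K

  -- edges of C_i : lines of direction i not through x
  EdgeC : AF.Point → AF.Dir → Set
  EdgeC x i = Σ FF.Carrier λ c → False (c FF.≟ AF.intercept i x)

  -- parallel classes of 𝒥 : directions of AG(2,p-1) other than d₁
  JClass : AK.Dir → Set
  JClass d₁ = Σ AK.Dir λ d → False (d AK.≟D d₁)

  data Vtx (x : AF.Point) : Set where
    avx : (pt : AF.Point) → False (pt AF.≟P x) → Vtx x
    jvx : AF.Dir → AK.Point → Vtx x

  module _ (x : AF.Point) (d₁ : AK.Dir)
           (σ : AF.Dir → (FK.Carrier ↔ Maybe (Fin (p ∸ 2))))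
           (τ : (i : AF.Dir) → (EdgeC x i ↔ JClass d₁)) where

    -- edge (i , e , c) = e ∪ f, where e ∈ C_i and f is the line with
    -- intercept c in the parallel class of 𝒥^i assigned to e
    GEdge : Set
    GEdge = Σ AF.Dir λ i → EdgeC x i × FK.Carrier

    _∈G_ : Vtx x → GEdge → Set
    avx pt _ ∈G (i , (b , _) , c) = pt AF.on (i , b)
    jvx j pt ∈G (i , e , c) =
      j ≡ i × pt AK.on (proj₁ (Inverse.to (τ i) e) , c)

    𝒢 : Hypergraph
    𝒢 = record { Vertex = Vtx x ; Edge = GEdge ; _∈ₑ_ = _∈G_ }

    -- vertex classes: inj₁ i ↦ V_i (i a direction of AG(2,p)),
    -- inj₂ k ↦ V_{p+2+k}; in total (p+1)+(p-2) = 2p-1 classes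
    cls : Vtx x → AF.Dir ⊎ Fin (p ∸ 2)
    cls (avx pt _) = inj₁ (AF.dirOf x pt)
    cls (jvx i pt) = maybe inj₂ (inj₁ i) (Inverse.to (σ i) (AK.intercept d₁ pt))

-- Uniformity, partiteness and intersection are incidence computations: two
-- lines of different directions meet in exactly one point (section
-- Incidence).  Let S be a cover.
-- If the 𝒜_p-vertices of S meet every line of AG(2,p) avoiding x, the
-- blocking-set bound of Jamison and Brouwer–Schrijver gives |S| ≥ 2(p-1).
-- Otherwise some edge e of C_i is missed; each of the p - 1 edges e ∪ f is
-- then covered inside f, giving p - 1 vertices of S in 𝒥^i, and a direction
-- j ≠ i supplies p - 1 further vertices: the blocking vertices of the edges
-- of C_j, or, if one of them is missed too, a second such family in 𝒥^j.
module Submission where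

open import Defs
open import Data.Nat as ℕ using (ℕ; zero; suc; _∸_)
import Data.Nat.Properties as ℕP
open import Data.Integer as ℤ using (ℤ; -[1+_]; _⊖_)
import Data.Integer.Properties as ℤP
open import Data.Fin using (Fin; punchIn)
open import Data.Fin.Properties using (punchInᵢ≢i; punchIn-injective)
open import Data.Bool.Properties using (T-irrelevant)
open import Data.Empty using (⊥; ⊥-elim)
open import Data.Maybe using (Maybe; just; nothing; maybe)
open import Data.Maybe.Properties using (just-injective)
open import Data.Product using (Σ; ∃-syntax; _×_; _,_; proj₁; proj₂)
open import Data.Sum using (_⊎_; inj₁; inj₂)
open import Data.Sum.Properties using (inj₁-injective)
open import Data.List using (List; []; _∷_; length; map; tabulate; _++_; mapMaybe)
open import Data.List.Properties using (length-map; length-++; length-tabulate; length-mapMaybe)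
open import Data.List.Membership.Propositional using (_∈_; find; lose)
open import Data.List.Membership.Propositional.Properties
  using (∈-map⁺; ∈-map⁻; ∈-++⁺ˡ; ∈-++⁺ʳ; ∈-++⁻; ∈-tabulate⁺; ∈-tabulate⁻)
open import Data.List.Relation.Unary.Any using (Any; any?; here; there)
open import Data.List.Relation.Unary.All as All using ()
open import Data.List.Relation.Unary.AllPairs using (_∷_)
open import Data.List.Relation.Unary.Unique.Propositional using (Unique)
open import Data.List.Relation.Unary.Unique.Propositional.Properties using (map⁺; ++⁺; tabulate⁺)
open import Algebra.Bundles using (CommutativeRing)
open import Algebra.Solver.Ring.AlmostCommutativeRing
  using (fromCommutativeRing; _-Raw-AlmostCommutative⟶_)
open import Function.Bundles using (Inverse; Injection; _↔_; mk⇔; mk↔ₛ′)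
open import Function.Construct.Symmetry using (↔-sym)
open import Function.Properties.Inverse using (Inverse⇒Injection)
open import Function.Definitions using (Injective)
open import Relation.Nullary using (¬_; Dec; yes; no)
open import Relation.Nullary.Decidable using (False; fromWitnessFalse; toWitnessFalse)
open import Relation.Binary.PropositionalEquality

↔-injective : ∀ {A B : Set} (f : A ↔ B) → Injective _≡_ _≡_ (Inverse.to f)
↔-injective f = Injection.injective (Inverse⇒Injection f)

module FieldArith {q : ℕ} (F : FiniteField q) where
  open FiniteField F public
  import Algebra.Properties.Ring as RingProps

  commutativeRing : CommutativeRing _ _
  commutativeRing = record { isCommutativeRing = isCommutativeRing }

  open CommutativeRing commutativeRing public
    using (+-assoc; +-comm; *-assoc; *-comm; +-identityˡ; +-identityʳ; *-identityˡ; *-identityʳ;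
           -‿inverseʳ; zeroˡ; zeroʳ; ring; semiring)
  open RingProps ring public using (-‿involutive; -0#≈0#; -‿distribˡ-*; -‿+-comm)
  open import Algebra.Properties.Semiring.Mult.TCOptimised semiring
    renaming (_×_ to _×ₙ_) using (1+×; ×-homo-+; ×1-homo-*)

  ⟦_⟧ℤ : ℤ → Carrier
  ⟦ ℤ.+ n ⟧ℤ  = n ×ₙ 1#
  ⟦ -[1+ n ] ⟧ℤ = - (suc n ×ₙ 1#)

  ⟦⟧-neg : ∀ z → ⟦ ℤ.- z ⟧ℤ ≡ - ⟦ z ⟧ℤ
  ⟦⟧-neg (ℤ.+ zero)  = sym -0#≈0#
  ⟦⟧-neg (ℤ.+ suc n) = refl
  ⟦⟧-neg -[1+ n ]    = sym (-‿involutive _)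

  shift-sub : ∀ a b → (1# + a) + - (1# + b) ≡ a + - b
  shift-sub a b = begin
    (1# + a) + - (1# + b)     ≡⟨ cong ((1# + a) +_) (sym (-‿+-comm 1# b)) ⟩
    (1# + a) + (- 1# + - b)   ≡⟨ +-assoc 1# a _ ⟩
    1# + (a + (- 1# + - b))   ≡⟨ cong (1# +_) (trans (sym (+-assoc a _ _)) (trans (cong (_+ - b) (+-comm a _)) (+-assoc _ a _))) ⟩
    1# + (- 1# + (a + - b))   ≡⟨ sym (+-assoc _ _ _) ⟩
    (1# + - 1#) + (a + - b)   ≡⟨ cong (_+ (a + - b)) (-‿inverseʳ 1#) ⟩
    0# + (a + - b)            ≡⟨ +-identityˡ _ ⟩
    a + - b                   ∎
    where open ≡-Reasoning

  ⟦⟧-⊖ : ∀ m n → ⟦ m ⊖ n ⟧ℤ ≡ m ×ₙ 1# + - (n ×ₙ 1#)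
  ⟦⟧-⊖ zero    zero    = sym (trans (cong (0# +_) -0#≈0#) (+-identityˡ _))
  ⟦⟧-⊖ (suc m) zero    = sym (trans (cong (suc m ×ₙ 1# +_) -0#≈0#) (+-identityʳ _))
  ⟦⟧-⊖ zero    (suc n) = sym (+-identityˡ _)
  ⟦⟧-⊖ (suc m) (suc n) = begin
    ⟦ suc m ⊖ suc n ⟧ℤ        ≡⟨ cong ⟦_⟧ℤ (ℤP.[1+m]⊖[1+n]≡m⊖n m n) ⟩
    ⟦ m ⊖ n ⟧ℤ                ≡⟨ ⟦⟧-⊖ m n ⟩
    m ×ₙ 1# + - (n ×ₙ 1#)       ≡⟨ sym (shift-sub _ _) ⟩
    (1# + m ×ₙ 1#) + - (1# + n ×ₙ 1#) ≡⟨ sym (cong₂ (λ a b → a + - b) (1+× m 1#) (1+× n 1#)) ⟩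
    suc m ×ₙ 1# + - (suc n ×ₙ 1#) ∎
    where open ≡-Reasoning

  ⟦⟧-+ : ∀ i j → ⟦ i ℤ.+ j ⟧ℤ ≡ ⟦ i ⟧ℤ + ⟦ j ⟧ℤ
  ⟦⟧-+ (ℤ.+ m)  (ℤ.+ n)  = ×-homo-+ 1# m n
  ⟦⟧-+ (ℤ.+ m)  -[1+ n ] = ⟦⟧-⊖ m (suc n)
  ⟦⟧-+ -[1+ m ] (ℤ.+ n)  = trans (⟦⟧-⊖ n (suc m)) (+-comm _ _)
  ⟦⟧-+ -[1+ m ] -[1+ n ] = begin
    - (suc (suc (m ℕ.+ n)) ×ₙ 1#)         ≡⟨ cong (λ k → - (suc k ×ₙ 1#)) (sym (ℕP.+-suc m n)) ⟩
    - ((suc m ℕ.+ suc n) ×ₙ 1#)           ≡⟨ cong -_ (×-homo-+ 1# (suc m) (suc n)) ⟩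
    - (suc m ×ₙ 1# + suc n ×ₙ 1#)          ≡⟨ sym (-‿+-comm _ _) ⟩
    - (suc m ×ₙ 1#) + - (suc n ×ₙ 1#)      ∎
    where open ≡-Reasoning

  ⟦⟧-*-pos : ∀ m j → ⟦ ℤ.+ m ℤ.* j ⟧ℤ ≡ m ×ₙ 1# * ⟦ j ⟧ℤ
  ⟦⟧-*-pos m (ℤ.+ n)  = trans (cong ⟦_⟧ℤ (sym (ℤP.pos-* m n))) (×1-homo-* m n)
  ⟦⟧-*-pos m -[1+ n ] = begin
    ⟦ ℤ.+ m ℤ.* ℤ.- (ℤ.+ suc n) ⟧ℤ       ≡⟨ cong ⟦_⟧ℤ (sym (ℤP.neg-distribʳ-* (ℤ.+ m) (ℤ.+ suc n))) ⟩
    ⟦ ℤ.- (ℤ.+ m ℤ.* ℤ.+ suc n) ⟧ℤ       ≡⟨ ⟦⟧-neg (ℤ.+ m ℤ.* ℤ.+ suc n) ⟩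
    - ⟦ ℤ.+ m ℤ.* ℤ.+ suc n ⟧ℤ           ≡⟨ cong -_ (⟦⟧-*-pos m (ℤ.+ suc n)) ⟩
    - (m ×ₙ 1# * (suc n ×ₙ 1#))            ≡⟨ trans (cong -_ (*-comm _ _)) (trans (-‿distribˡ-* _ _) (*-comm _ _)) ⟩
    m ×ₙ 1# * - (suc n ×ₙ 1#)              ∎
    where open ≡-Reasoning

  ⟦⟧-* : ∀ i j → ⟦ i ℤ.* j ⟧ℤ ≡ ⟦ i ⟧ℤ * ⟦ j ⟧ℤ
  ⟦⟧-* (ℤ.+ m)  j = ⟦⟧-*-pos m j
  ⟦⟧-* -[1+ m ] j = begin
    ⟦ ℤ.- (ℤ.+ suc m) ℤ.* j ⟧ℤ           ≡⟨ cong ⟦_⟧ℤ (sym (ℤP.neg-distribˡ-* (ℤ.+ suc m) j)) ⟩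
    ⟦ ℤ.- (ℤ.+ suc m ℤ.* j) ⟧ℤ           ≡⟨ ⟦⟧-neg (ℤ.+ suc m ℤ.* j) ⟩
    - ⟦ ℤ.+ suc m ℤ.* j ⟧ℤ               ≡⟨ cong -_ (⟦⟧-*-pos (suc m) j) ⟩
    - (suc m ×ₙ 1# * ⟦ j ⟧ℤ)              ≡⟨ -‿distribˡ-* _ _ ⟩
    - (suc m ×ₙ 1#) * ⟦ j ⟧ℤ              ∎
    where open ≡-Reasoning

  ℤ⟶F : ℤ.+-*-rawRing -Raw-AlmostCommutative⟶ fromCommutativeRing commutativeRing
  ℤ⟶F = record { ⟦_⟧ = ⟦_⟧ℤ ; +-homo = ⟦⟧-+ ; *-homo = ⟦⟧-* ; -‿homo = ⟦⟧-neg
               ; 0-homo = refl ; 1-homo = refl }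

  -- the solver only needs to recognise equal integer coefficients
  ℤ-coefficients-equal? : ∀ i j → Maybe (⟦ i ⟧ℤ ≡ ⟦ j ⟧ℤ)
  ℤ-coefficients-equal? i j with i ℤ.≟ j
  ... | yes refl = just refl
  ... | no _     = nothing

  open import Algebra.Solver.Ring ℤ.+-*-rawRing (fromCommutativeRing commutativeRing) ℤ⟶F ℤ-coefficients-equal? public
    using (Polynomial; solve; _:+_; _:*_; _:-_; :-_; con; _:=_)

  :0 :1 : ∀ {n} → Polynomial n
  :0 = con (ℤ.+ 0)
  :1 = con (ℤ.+ 1)

  difference-zero⇒≡ : ∀ {a b} → a + - b ≡ 0# → a ≡ b
  difference-zero⇒≡ {a} {b} h = begin
    a               ≡⟨ solve 2 (λ a b → a := (a :- b) :+ b) refl a b ⟩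
    (a + - b) + b   ≡⟨ cong (_+ b) h ⟩
    0# + b          ≡⟨ +-identityˡ b ⟩
    b               ∎
    where open ≡-Reasoning

  ≡⇒difference-zero : ∀ {a b} → a ≡ b → a + - b ≡ 0#
  ≡⇒difference-zero {a} refl = -‿inverseʳ a

  no-zero-divisors : ∀ {a b} → ¬ a ≡ 0# → a * b ≡ 0# → b ≡ 0#
  no-zero-divisors {a} {b} a≢0 ab≡0 = begin
    b                                  ≡⟨ solve 3 (λ a b i → b := b :* :1 :+ i :* (a :* b) :- (a :* i) :* b) refl a b (a ⁻¹) ⟩
    b * 1# + a ⁻¹ * (a * b) + - ((a * a ⁻¹) * b)
                                       ≡⟨ cong₂ (λ z w → b * 1# + a ⁻¹ * z + - (w * b)) ab≡0 (⁻¹-inverse a a≢0) ⟩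
    b * 1# + a ⁻¹ * 0# + - (1# * b)    ≡⟨ solve 2 (λ b i → b :* :1 :+ i :* :0 :- :1 :* b := :0) refl b (a ⁻¹) ⟩
    0#                                 ∎
    where open ≡-Reasoning

  ⁻¹≢0 : ∀ {a} → ¬ a ≡ 0# → ¬ a ⁻¹ ≡ 0#
  ⁻¹≢0 {a} a≢0 h = 0≢1 (trans (sym (zeroʳ a)) (trans (cong (a *_) (sym h)) (⁻¹-inverse a a≢0)))

  -1≢0 : ¬ (- 1#) ≡ 0#
  -1≢0 h = 0≢1 (sym (trans (sym (-‿involutive 1#)) (trans (cong -_ h) -0#≈0#)))

module Incidence {q : ℕ} (F : FiniteField q) where
  open FieldArith F
  open AG F

  on⇒intercept : ∀ {pt d c} → pt on (d , c) → c ≡ intercept d pt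
  on⇒intercept {a , b} {nothing}     h    = sym h
  on⇒intercept {a , b} {just m} {c} refl = solve 3 (λ m a c → c := (m :* a :+ c) :- m :* a) refl m a c

  intercept-on : ∀ pt d → pt on (d , intercept d pt)
  intercept-on (a , b) nothing  = refl
  intercept-on (a , b) (just m) = solve 3 (λ m a b → b := m :* a :+ (b :- m :* a)) refl m a b

  intercept⇒on : ∀ {pt d c} → c ≡ intercept d pt → pt on (d , c)
  intercept⇒on {pt} {d} refl = intercept-on pt d

  dirOf-on : ∀ x u → u on (dirOf x u , intercept (dirOf x u) x)
  dirOf-on (x₁ , x₂) (a , b) with x₁ ≟ a
  ... | yes x₁≡a = sym x₁≡a
  ... | no  x₁≢a = begin
    b                                              ≡⟨ solve 2 (λ b x₂ → b := (b :- x₂) :* :1 :+ x₂) refl b x₂ ⟩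
    (b + - x₂) * 1# + x₂                           ≡⟨ cong (λ z → (b + - x₂) * z + x₂) (sym inverse) ⟩
    (b + - x₂) * ((a + - x₁) ⁻¹ * (a + - x₁)) + x₂ ≡⟨ solve 5 (λ b x₂ i a x₁ → (b :- x₂) :* (i :* (a :- x₁)) :+ x₂
                                                          := ((b :- x₂) :* i) :* a :+ (x₂ :- ((b :- x₂) :* i) :* x₁))
                                                        refl b x₂ ((a + - x₁) ⁻¹) a x₁ ⟩
    slope * a + (x₂ + - (slope * x₁))              ∎
    where
    open ≡-Reasoning
    slope = (b + - x₂) * ((a + - x₁) ⁻¹)
    inverse : (a + - x₁) ⁻¹ * (a + - x₁) ≡ 1#
    inverse = trans (*-comm _ _) (⁻¹-inverse _ (λ e → x₁≢a (sym (difference-zero⇒≡ e))))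

  meet-unique : ∀ {d d′ c c′ u v} → ¬ d ≡ d′ →
    u on (d , c) → u on (d′ , c′) → v on (d , c) → v on (d′ , c′) → u ≡ v
  meet-unique {nothing} {nothing} d≢d′ _ _ _ _ = ⊥-elim (d≢d′ refl)
  meet-unique {nothing} {just m}  _ refl refl refl refl = refl
  meet-unique {just m}  {nothing} _ refl refl refl refl = refl
  meet-unique {just m}  {just m′} {c} {c′} {a , b} {a′ , b′} d≢d′ u∈ u∈′ v∈ v∈′ =
    cong₂ _,_ a≡a′ (trans u∈ (trans (cong (λ z → m * z + c) a≡a′) (sym v∈)))
    where
    open ≡-Reasoning
    product-zero : (m + - m′) * (a + - a′) ≡ 0#
    product-zero = begin
      (m + - m′) * (a + - a′)
        ≡⟨ solve 6 (λ m m′ a a′ c c′ → (m :- m′) :* (a :- a′)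
               := ((m :* a :+ c) :- (m′ :* a :+ c′)) :- ((m :* a′ :+ c) :- (m′ :* a′ :+ c′))) refl m m′ a a′ c c′ ⟩
      ((m * a + c) + - (m′ * a + c′)) + - ((m * a′ + c) + - (m′ * a′ + c′))
        ≡⟨ cong₂ (λ z w → z + - w) (≡⇒difference-zero (trans (sym u∈) u∈′)) (≡⇒difference-zero (trans (sym v∈) v∈′)) ⟩
      0# + - 0#
        ≡⟨ -‿inverseʳ 0# ⟩
      0# ∎
    a≡a′ : a ≡ a′
    a≡a′ = difference-zero⇒≡ (no-zero-divisors (λ e → d≢d′ (cong just (difference-zero⇒≡ e))) product-zero)

  meet : ∀ {d d′} c c′ → ¬ d ≡ d′ → Σ Point λ u → u on (d , c) × u on (d′ , c′)
  meet {nothing} {nothing} c c′ d≢d′ = ⊥-elim (d≢d′ refl)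
  meet {nothing} {just m}  c c′ _ = (c , m * c + c′) , refl , refl
  meet {just m}  {nothing} c c′ _ = (c′ , m * c′ + c) , refl , refl
  meet {just m}  {just m′} c c′ d≢d′ = (a , m * a + c) , refl , difference-zero⇒≡ balance
    where
    open ≡-Reasoning
    δ = m + - m′
    δ≢0 : ¬ δ ≡ 0#
    δ≢0 e = d≢d′ (cong just (difference-zero⇒≡ e))
    a = (c′ + - c) * δ ⁻¹
    balance : (m * a + c) + - (m′ * a + c′) ≡ 0#
    balance = begin
      (m * a + c) + - (m′ * a + c′)
        ≡⟨ solve 5 (λ m m′ c c′ i → (m :* ((c′ :- c) :* i) :+ c) :- (m′ :* ((c′ :- c) :* i) :+ c′)
               := (c′ :- c) :* ((m :- m′) :* i) :- (c′ :- c)) refl m m′ c c′ (δ ⁻¹) ⟩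
      (c′ + - c) * (δ * δ ⁻¹) + - (c′ + - c)
        ≡⟨ cong (λ z → (c′ + - c) * z + - (c′ + - c)) (⁻¹-inverse δ δ≢0) ⟩
      (c′ + - c) * 1# + - (c′ + - c)
        ≡⟨ solve 1 (λ z → z :* :1 :- z := :0) refl (c′ + - c) ⟩
      0# ∎

  on? : ∀ pt ℓ → Dec (pt on ℓ)
  on? (a , b) (nothing , c) = a ≟ c
  on? (a , b) (just m  , c) = b ≟ (m * a + c)

  pointAt : Line → Carrier → Point
  pointAt (nothing , c) t = c , t
  pointAt (just m  , c) t = t , m * t + c

  pointAt-on : ∀ ℓ t → pointAt ℓ t on ℓ
  pointAt-on (nothing , c) t = refl
  pointAt-on (just m  , c) t = refl

  on⇒pointAt : ∀ {ℓ pt} → pt on ℓ → ∃[ t ] pt ≡ pointAt ℓ t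
  on⇒pointAt {nothing , c} {a , b} refl = b , refl
  on⇒pointAt {just m  , c} {a , b} refl = a , refl

  pointAt-injective : ∀ ℓ {t t′} → pointAt ℓ t ≡ pointAt ℓ t′ → t ≡ t′
  pointAt-injective (nothing , c) refl = refl
  pointAt-injective (just m  , c) refl = refl

module Counting where

  remove : ∀ {A : Set} {x : A} (ys : List A) → x ∈ ys → List A
  remove (y ∷ ys) (here _)  = ys
  remove (y ∷ ys) (there m) = y ∷ remove ys m

  length-remove : ∀ {A : Set} {x : A} (ys : List A) (m : x ∈ ys) → suc (length (remove ys m)) ≡ length ys
  length-remove (y ∷ ys) (here _)  = refl
  length-remove (y ∷ ys) (there m) = cong suc (length-remove ys m)

  ∈-remove : ∀ {A : Set} {x v : A} (ys : List A) (m : x ∈ ys) → v ∈ ys → ¬ v ≡ x → v ∈ remove ys m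
  ∈-remove (y ∷ ys) (here refl) (here refl)  v≢x = ⊥-elim (v≢x refl)
  ∈-remove (y ∷ ys) (here refl) (there v∈)   v≢x = v∈
  ∈-remove (y ∷ ys) (there m)   (here v≡y)   v≢x = here v≡y
  ∈-remove (y ∷ ys) (there m)   (there v∈)   v≢x = there (∈-remove ys m v∈ v≢x)

  unique-⊆⇒length-≤ : ∀ {A : Set} (xs ys : List A) → Unique xs → (∀ {a} → a ∈ xs → a ∈ ys) →
    length xs ℕ.≤ length ys
  unique-⊆⇒length-≤ []       ys _           _   = ℕ.z≤n
  unique-⊆⇒length-≤ (x ∷ xs) ys (x∉xs ∷ xs!) xs⊆ys =
    subst (suc (length xs) ℕ.≤_) (length-remove ys x∈ys)
      (ℕ.s≤s (unique-⊆⇒length-≤ xs (remove ys x∈ys) xs!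
        (λ a∈xs → ∈-remove ys x∈ys (xs⊆ys (there a∈xs)) (λ a≡x → All.lookup x∉xs a∈xs (sym a≡x)))))
    where x∈ys = xs⊆ys (here refl)

  disjoint-families-bound : ∀ {A : Set} {n} (S : List A) (f g : Fin n → A) →
    Injective _≡_ _≡_ f → Injective _≡_ _≡_ g → (∀ s t → ¬ f s ≡ g t) →
    (∀ t → f t ∈ S) → (∀ t → g t ∈ S) → n ℕ.+ n ℕ.≤ length S
  disjoint-families-bound {n = n} S f g f-inj g-inj f≢g f∈S g∈S =
    subst (ℕ._≤ length S) both-lengths (unique-⊆⇒length-≤ (tabulate f ++ tabulate g) S both-unique both-⊆)
    where
    both-unique : Unique (tabulate f ++ tabulate g)
    both-unique = ++⁺ (tabulate⁺ f-inj) (tabulate⁺ g-inj) λ (v∈f , v∈g) →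
      let (s , v≡fs) = ∈-tabulate⁻ v∈f ; (t , v≡gt) = ∈-tabulate⁻ v∈g in f≢g s t (trans (sym v≡fs) v≡gt)
    both-⊆ : ∀ {a} → a ∈ tabulate f ++ tabulate g → a ∈ S
    both-⊆ a∈ with ∈-++⁻ (tabulate f) a∈
    ... | inj₁ a∈f = let (s , a≡fs) = ∈-tabulate⁻ a∈f in subst (_∈ S) (sym a≡fs) (f∈S s)
    ... | inj₂ a∈g = let (t , a≡gt) = ∈-tabulate⁻ a∈g in subst (_∈ S) (sym a≡gt) (g∈S t)
    both-lengths : length (tabulate f ++ tabulate g) ≡ n ℕ.+ n
    both-lengths = trans (length-++ (tabulate f)) (cong₂ ℕ._+_ (length-tabulate f) (length-tabulate g))

  all-or-counterexample : ∀ {A : Set} {P : A → Set} → (∀ a → Dec (P a)) → ∀ xs →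
    (∀ {a} → a ∈ xs → P a) ⊎ ∃[ a ] ¬ P a
  all-or-counterexample P? []       = inj₁ (λ ())
  all-or-counterexample P? (a ∷ xs) with P? a | all-or-counterexample P? xs
  ... | no ¬Pa | _              = inj₂ (a , ¬Pa)
  ... | yes Pa | inj₂ counter   = inj₂ counter
  ... | yes Pa | inj₁ all-P     = inj₁ λ { (here refl) → Pa ; (there a∈) → all-P a∈ }

module Elements {n : ℕ} (F : FiniteField (suc n)) where
  open FiniteField F
  open Inverse card public using () renaming (to to elementAt; from to indexOf;
    strictlyInverseˡ to elementAt-indexOf; strictlyInverseʳ to indexOf-elementAt)

  elementAt-injective : Injective _≡_ _≡_ elementAt
  elementAt-injective = ↔-injective card

  elements : List Carrier
  elements = tabulate elementAt

  ∈-elements : ∀ a → a ∈ elements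
  ∈-elements a = subst (_∈ elements) (elementAt-indexOf a) (∈-tabulate⁺ {f = elementAt} (indexOf a))

  elements-unique : Unique elements
  elements-unique = tabulate⁺ elementAt-injective

  except : Carrier → Fin n → Carrier
  except a k = elementAt (punchIn (indexOf a) k)

  except-≢ : ∀ a k → ¬ except a k ≡ a
  except-≢ a k e = punchInᵢ≢i (indexOf a) k (trans (sym (indexOf-elementAt _)) (cong indexOf e))

  except-injective : ∀ a → Injective _≡_ _≡_ (except a)
  except-injective a e = punchIn-injective (indexOf a) _ _ (elementAt-injective e)

  except-≢-list : ∀ a {c} → c ∈ tabulate (except a) → ¬ c ≡ a
  except-≢-list a c∈ with ∈-tabulate⁻ c∈
  ... | k , refl = except-≢ a k

module Sums {n : ℕ} (F : FiniteField (suc n)) where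
  open FieldArith F
  open Elements F using (elementAt; indexOf; elementAt-indexOf; indexOf-elementAt; except; except-≢)
  open import Algebra.Properties.Semiring.Sum semiring
    using (sum; sum-cong-≗; sum-permute; ∑-distrib-+; *-distribˡ-sum; sum-remove; sum-replicate-zero)

  ∑ : (Carrier → Carrier) → Carrier
  ∑ f = sum (λ k → f (elementAt k))

  ∑-cong : ∀ {f g} → (∀ u → f u ≡ g u) → ∑ f ≡ ∑ g
  ∑-cong f≗g = sum-cong-≗ (λ k → f≗g (elementAt k))

  ∑-+ : ∀ f g → ∑ (λ u → f u + g u) ≡ ∑ f + ∑ g
  ∑-+ f g = ∑-distrib-+ (λ k → f (elementAt k)) (λ k → g (elementAt k))

  ∑-* : ∀ c f → ∑ (λ u → c * f u) ≡ c * ∑ f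
  ∑-* c f = sym (*-distribˡ-sum c (λ k → f (elementAt k)))

  ∑-zero : ∀ f → (∀ u → f u ≡ 0#) → ∑ f ≡ 0#
  ∑-zero f f≗0 = trans (∑-cong f≗0) (sum-replicate-zero (suc n))

  ∑-single : ∀ f a → (∀ u → ¬ u ≡ a → f u ≡ 0#) → ∑ f ≡ f a
  ∑-single f a off-a = begin
    ∑ f                                            ≡⟨ sum-remove {n} {indexOf a} (λ k → f (elementAt k)) ⟩
    f (elementAt (indexOf a)) + sum (λ k → f (except a k))
                                                   ≡⟨ cong₂ _+_ (cong f (elementAt-indexOf a)) rest-zero ⟩
    f a + 0#                                       ≡⟨ +-identityʳ _ ⟩
    f a                                            ∎
    where
    open ≡-Reasoning
    rest-zero : sum (λ k → f (except a k)) ≡ 0#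
    rest-zero = trans (sum-cong-≗ λ k → off-a (except a k) (except-≢ a k)) (sum-replicate-zero n)

  ∑-reindex : ∀ (π π⁻ : Carrier → Carrier) → (∀ u → π (π⁻ u) ≡ u) → (∀ u → π⁻ (π u) ≡ u) →
    ∀ f → ∑ (λ u → f (π u)) ≡ ∑ f
  ∑-reindex π π⁻ ππ⁻ π⁻π f = sym (trans (sum-permute {suc n} {suc n} (λ k → f (elementAt k)) ρ)
                                   (∑-cong {λ u → f (elementAt (indexOf (π u)))} (λ u → cong f (elementAt-indexOf (π u)))))
    where
    ρ = mk↔ₛ′ (λ k → indexOf (π (elementAt k))) (λ k → indexOf (π⁻ (elementAt k)))
          (λ k → trans (cong (λ z → indexOf (π z)) (elementAt-indexOf _)) (trans (cong indexOf (ππ⁻ _)) (indexOf-elementAt k)))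
          (λ k → trans (cong (λ z → indexOf (π⁻ z)) (elementAt-indexOf _)) (trans (cong indexOf (π⁻π _)) (indexOf-elementAt k)))

  -- the characteristic divides the order: adding 1 to every element permutes F
  ∑-one : ∑ (λ _ → 1#) ≡ 0#
  ∑-one = begin
    ∑ (λ _ → 1#)                          ≡⟨ solve 2 (λ a b → b := (a :+ b) :- a) refl (∑ (λ u → u)) _ ⟩
    (∑ (λ u → u) + ∑ (λ _ → 1#)) + - ∑ (λ u → u) ≡⟨ cong (_+ - ∑ (λ u → u)) (sym (∑-+ (λ u → u) (λ _ → 1#))) ⟩
    ∑ (λ u → u + 1#) + - ∑ (λ u → u)      ≡⟨ cong (_+ - ∑ (λ u → u)) (∑-reindex (_+ 1#) (_+ - 1#)
                                                (solve 1 (λ u → u :- :1 :+ :1 := u) refl)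
                                                (solve 1 (λ u → u :+ :1 :- :1 := u) refl) (λ u → u)) ⟩
    ∑ (λ u → u) + - ∑ (λ u → u)           ≡⟨ -‿inverseʳ _ ⟩
    0#                                    ∎
    where open ≡-Reasoning

  ∑∑ : (Carrier → Carrier → Carrier) → Carrier
  ∑∑ f = ∑ (λ u → ∑ (λ v → f u v))

  ∑∑-cong : ∀ {f g} → (∀ u v → f u v ≡ g u v) → ∑∑ f ≡ ∑∑ g
  ∑∑-cong f≗g = ∑-cong (λ u → ∑-cong (f≗g u))

  ∑∑-+ : ∀ f g → ∑∑ (λ u v → f u v + g u v) ≡ ∑∑ f + ∑∑ g
  ∑∑-+ f g = trans (∑-cong (λ u → ∑-+ (f u) (g u))) (∑-+ (λ u → ∑ (f u)) (λ u → ∑ (g u)))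

  ∑∑-* : ∀ c f → ∑∑ (λ u v → c * f u v) ≡ c * ∑∑ f
  ∑∑-* c f = trans (∑-cong (λ u → ∑-* c (f u))) (∑-* c (λ u → ∑ (f u)))

module Polynomials {q : ℕ} (F : FiniteField q) where
  open FieldArith F

  eval : List Carrier → Carrier → Carrier
  eval []       u = 0#
  eval (a ∷ as) u = a + u * eval as u

  -- synthetic division by (X - c); the remainder is eval P c
  quotient : List Carrier → Carrier → List Carrier
  quotient []           c = []
  quotient (a ∷ [])     c = []
  quotient (a ∷ b ∷ bs) c = eval (b ∷ bs) c ∷ quotient (b ∷ bs) c

  length-quotient : ∀ a as c → length (quotient (a ∷ as) c) ≡ length as
  length-quotient a []       c = refl
  length-quotient a (b ∷ bs) c = cong suc (length-quotient b bs c)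

  division : ∀ P c u → eval P u ≡ (u + - c) * eval (quotient P c) u + eval P c
  division []           c u = solve 2 (λ u c → :0 := (u :- c) :* :0 :+ :0) refl u c
  division (a ∷ [])     c u = solve 3 (λ a u c → a :+ u :* :0 := (u :- c) :* :0 :+ (a :+ c :* :0)) refl a u c
  division (a ∷ b ∷ bs) c u = begin
    a + u * eval (b ∷ bs) u                           ≡⟨ cong (λ z → a + u * z) (division (b ∷ bs) c u) ⟩
    a + u * ((u + - c) * eval Q u + eval (b ∷ bs) c)  ≡⟨ solve 5 (λ a u c E Qu → a :+ u :* ((u :- c) :* Qu :+ E)
                                                              := (u :- c) :* (E :+ u :* Qu) :+ (a :+ c :* E))
                                                           refl a u c (eval (b ∷ bs) c) (eval Q u) ⟩
    (u + - c) * (eval (b ∷ bs) c + u * eval Q u) + (a + c * eval (b ∷ bs) c) ∎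
    where
    open ≡-Reasoning
    Q = quotient (b ∷ bs) c

  root-bound : ∀ R P → Unique R → length P ℕ.≤ length R → (∀ {c} → c ∈ R → eval P c ≡ 0#) →
    ∀ u → eval P u ≡ 0#
  root-bound R        []      _            _            _     u = refl
  root-bound []       (a ∷ P) _            ()           _     u
  root-bound (c ∷ R) (a ∷ P) (c∉R ∷ R!) (ℕ.s≤s |P|≤|R|) roots u = begin
    eval (a ∷ P) u                        ≡⟨ division (a ∷ P) c u ⟩
    (u + - c) * eval Q u + eval (a ∷ P) c ≡⟨ cong₂ (λ z w → (u + - c) * z + w) (Q-vanishes u) (roots (here refl)) ⟩
    (u + - c) * 0# + 0#                   ≡⟨ solve 2 (λ u c → (u :- c) :* :0 :+ :0 := :0) refl u c ⟩
    0#                                    ∎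
    where
    open ≡-Reasoning
    Q = quotient (a ∷ P) c
    Q-roots : ∀ {c′} → c′ ∈ R → eval Q c′ ≡ 0#
    Q-roots {c′} c′∈R = no-zero-divisors (λ e → All.lookup c∉R c′∈R (sym (difference-zero⇒≡ e)))
      (trans (sym (+-identityʳ _)) (trans (cong ((c′ + - c) * eval Q c′ +_) (sym (roots (here refl))))
        (trans (sym (division (a ∷ P) c c′)) (roots (there c′∈R)))))
    Q-vanishes : ∀ u → eval Q u ≡ 0#
    Q-vanishes = root-bound R Q R! (subst (ℕ._≤ length R) (sym (length-quotient a P c)) |P|≤|R|) Q-roots

module PowerSums {n : ℕ} (F : FiniteField (suc n)) where
  open FieldArith F
  open Sums F
  open Polynomials F
  open Elements F using (except; except-injective; except-≢-list)
  open import Algebra.Properties.CommutativeSemiring.Exp (CommutativeRing.commutativeSemiring commutativeRing)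
    public using (_^_; ^-distrib-*)

  monomial : ℕ → List Carrier
  monomial zero    = 1# ∷ []
  monomial (suc j) = 0# ∷ monomial j

  length-monomial : ∀ j → length (monomial j) ≡ suc j
  length-monomial zero    = refl
  length-monomial (suc j) = cong suc (length-monomial j)

  eval-monomial : ∀ j u → eval (monomial j) u ≡ u ^ j
  eval-monomial zero    u = trans (cong (1# +_) (zeroʳ u)) (+-identityʳ 1#)
  eval-monomial (suc j) u = trans (+-identityˡ _) (cong (u *_) (eval-monomial j u))

  X^[1+j]-1 : ℕ → List Carrier
  X^[1+j]-1 j = - 1# ∷ monomial j

  eval-X^[1+j]-1 : ∀ j u → eval (X^[1+j]-1 j) u ≡ u ^ suc j + - 1#
  eval-X^[1+j]-1 j u = trans (cong (- 1# +_) (cong (u *_) (eval-monomial j u))) (+-comm _ _)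

  -- if ∑ u^j ≠ 0 then c^j = 1 for every c ≠ 0, since u ↦ c·u permutes F
  nonzero-power-sum⇒unit-powers : ∀ j → ¬ ∑ (λ u → u ^ j) ≡ 0# → ∀ c → ¬ c ≡ 0# → c ^ j ≡ 1#
  nonzero-power-sum⇒unit-powers j ∑≢0 c c≢0 = difference-zero⇒≡ (no-zero-divisors ∑≢0 (trans (*-comm _ _) (begin
    (c ^ j + - 1#) * ∑ᵢ                      ≡⟨ solve 2 (λ a s → (a :- :1) :* s := a :* s :- s) refl (c ^ j) ∑ᵢ ⟩
    c ^ j * ∑ᵢ + - ∑ᵢ                        ≡⟨ cong (_+ - ∑ᵢ) (sym (∑-* (c ^ j) (λ u → u ^ j))) ⟩
    ∑ (λ u → c ^ j * u ^ j) + - ∑ᵢ           ≡⟨ cong (_+ - ∑ᵢ) (∑-cong (λ u → sym (^-distrib-* c u j))) ⟩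
    ∑ (λ u → (c * u) ^ j) + - ∑ᵢ             ≡⟨ cong (_+ - ∑ᵢ) (∑-reindex (c *_) (c ⁻¹ *_) c·c⁻¹· c⁻¹·c· (_^ j)) ⟩
    ∑ᵢ + - ∑ᵢ                                ≡⟨ -‿inverseʳ ∑ᵢ ⟩
    0#                                       ∎)))
    where
    open ≡-Reasoning
    ∑ᵢ = ∑ (λ u → u ^ j)
    c·c⁻¹· : ∀ u → c * (c ⁻¹ * u) ≡ u
    c·c⁻¹· u = trans (sym (*-assoc _ _ _)) (trans (cong (_* u) (⁻¹-inverse c c≢0)) (*-identityˡ u))
    c⁻¹·c· : ∀ u → c ⁻¹ * (c * u) ≡ u
    c⁻¹·c· u = trans (sym (*-assoc _ _ _)) (trans (cong (_* u) (trans (*-comm _ _) (⁻¹-inverse c c≢0))) (*-identityˡ u))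

  power-sum-vanishes : ∀ j → j ℕ.< n → ∑ (λ u → u ^ j) ≡ 0#
  power-sum-vanishes zero    _   = ∑-one
  power-sum-vanishes (suc j) j<n with ∑ (λ u → u ^ suc j) ≟ 0#
  ... | yes ∑≡0 = ∑≡0
  ... | no  ∑≢0 = ⊥-elim (-1≢0 (begin
    - 1#                                ≡⟨ solve 2 (λ m z → m := :0 :* z :+ m) refl (- 1#) (0# ^ j) ⟩
    0# * 0# ^ j + - 1#                  ≡⟨ sym (eval-X^[1+j]-1 j 0#) ⟩
    eval (X^[1+j]-1 j) 0#               ≡⟨ root-bound nonzero (X^[1+j]-1 j) (tabulate⁺ (except-injective 0#))
                                             degree≤roots roots 0# ⟩
    0#                                  ∎))
    where
    open ≡-Reasoning
    nonzero = tabulate (except 0#)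
    degree≤roots : length (X^[1+j]-1 j) ℕ.≤ length nonzero
    degree≤roots = subst₂ ℕ._≤_ (cong suc (sym (length-monomial j))) (sym (length-tabulate (except 0#))) j<n
    roots : ∀ {c} → c ∈ nonzero → eval (X^[1+j]-1 j) c ≡ 0#
    roots {c} c∈ = trans (eval-X^[1+j]-1 j c)
                     (≡⇒difference-zero (nonzero-power-sum⇒unit-powers (suc j) ∑≢0 c (except-≢-list 0# c∈)))

-- Translating x to the origin, the polynomial
-- Π_{t∈T} (1 - t₁u - t₂v) vanishes on every (u,v) ≠ (0,0) and is 1 at the
-- origin, so its sum over F² is 1; but every polynomial of degree below 2n
-- sums to 0 over F².
module BlockingSets {n : ℕ} (F : FiniteField (suc n)) where
  open FieldArith F
  open Sums F
  open PowerSums F using (_^_; power-sum-vanishes)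
  open AG F using (Point; _on_; intercept)

  form : Carrier × Carrier → Carrier → Carrier → Carrier
  form (t₁ , t₂) u v = 1# + - (t₁ * u) + - (t₂ * v)

  product : List (Carrier × Carrier) → Carrier → Carrier → Carrier
  product []      u v = 1#
  product (t ∷ L) u v = form t u v * product L u v

  product-zero : ∀ L {t} u v → t ∈ L → form t u v ≡ 0# → product L u v ≡ 0#
  product-zero (t ∷ L) u v (here refl) h = trans (cong (_* product L u v) h) (zeroˡ _)
  product-zero (t ∷ L) u v (there t∈) h = trans (cong (form t u v *_) (product-zero L u v t∈ h)) (zeroʳ _)

  product-origin : ∀ L → product L 0# 0# ≡ 1#
  product-origin []              = refl
  product-origin ((t₁ , t₂) ∷ L) = trans (cong (form (t₁ , t₂) 0# 0# *_) (product-origin L))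
    (solve 2 (λ a b → (:1 :- a :* :0 :- b :* :0) :* :1 := :1) refl t₁ t₂)

  -- a monomial u^i v^j with i + j < 2n has u-degree or v-degree below n
  monomial-sum-vanishes : ∀ i j → i ℕ.+ j ℕ.< n ℕ.+ n → ∑∑ (λ u v → u ^ i * v ^ j) ≡ 0#
  monomial-sum-vanishes i j i+j<2n = begin
    ∑∑ (λ u v → u ^ i * v ^ j)   ≡⟨ ∑-cong (λ u → ∑-* (u ^ i) (λ v → v ^ j)) ⟩
    ∑ (λ u → u ^ i * ∑ⱼ)         ≡⟨ ∑-cong (λ u → *-comm (u ^ i) ∑ⱼ) ⟩
    ∑ (λ u → ∑ⱼ * u ^ i)         ≡⟨ ∑-* ∑ⱼ (λ u → u ^ i) ⟩
    ∑ⱼ * ∑ᵢ                      ≡⟨ one-vanishes (i ℕ.<? n) (j ℕ.<? n) ⟩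
    0#                           ∎
    where
    open ≡-Reasoning
    ∑ᵢ = ∑ (λ u → u ^ i)
    ∑ⱼ = ∑ (λ v → v ^ j)
    one-vanishes : Dec (i ℕ.< n) → Dec (j ℕ.< n) → ∑ⱼ * ∑ᵢ ≡ 0#
    one-vanishes (yes i<n) _         = trans (cong (∑ⱼ *_) (power-sum-vanishes i i<n)) (zeroʳ _)
    one-vanishes (no _)    (yes j<n) = trans (cong (_* ∑ᵢ) (power-sum-vanishes j j<n)) (zeroˡ _)
    one-vanishes (no i≮n)  (no j≮n)  =
      ⊥-elim (ℕP.<⇒≱ i+j<2n (ℕP.+-mono-≤ (ℕP.≮⇒≥ i≮n) (ℕP.≮⇒≥ j≮n)))

  -- multiplying by u^i v^j and expanding the first form lowers the
  -- number of forms while raising the degree of the monomial by at most one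
  twisted-sum-vanishes : ∀ L i j → i ℕ.+ j ℕ.+ length L ℕ.< n ℕ.+ n →
    ∑∑ (λ u v → u ^ i * v ^ j * product L u v) ≡ 0#
  twisted-sum-vanishes [] i j bound = begin
    ∑∑ (λ u v → u ^ i * v ^ j * 1#) ≡⟨ ∑∑-cong (λ u v → *-identityʳ (u ^ i * v ^ j)) ⟩
    ∑∑ (λ u v → u ^ i * v ^ j)      ≡⟨ monomial-sum-vanishes i j (subst (ℕ._< n ℕ.+ n) (ℕP.+-identityʳ _) bound) ⟩
    0#                              ∎
    where open ≡-Reasoning
  twisted-sum-vanishes ((t₁ , t₂) ∷ L) i j bound = begin
    ∑∑ (λ u v → u ^ i * v ^ j * (form (t₁ , t₂) u v * product L u v))
      ≡⟨ ∑∑-cong (λ u v → solve 7 (λ U V u v t₁ t₂ P → U :* V :* ((:1 :- t₁ :* u :- t₂ :* v) :* P)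
           := U :* V :* P :+ (:- t₁ :* ((u :* U) :* V :* P) :+ :- t₂ :* (U :* (v :* V) :* P)))
           refl (u ^ i) (v ^ j) u v t₁ t₂ (product L u v)) ⟩
    ∑∑ (λ u v → A u v + (- t₁ * B u v + - t₂ * C u v))
      ≡⟨ ∑∑-+ A (λ u v → - t₁ * B u v + - t₂ * C u v) ⟩
    ∑∑ A + ∑∑ (λ u v → - t₁ * B u v + - t₂ * C u v)
      ≡⟨ cong (∑∑ A +_) (∑∑-+ (λ u v → - t₁ * B u v) (λ u v → - t₂ * C u v)) ⟩
    ∑∑ A + (∑∑ (λ u v → - t₁ * B u v) + ∑∑ (λ u v → - t₂ * C u v))
      ≡⟨ cong₂ (λ z w → ∑∑ A + (z + w)) (∑∑-* (- t₁) B) (∑∑-* (- t₂) C) ⟩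
    ∑∑ A + (- t₁ * ∑∑ B + - t₂ * ∑∑ C)
      ≡⟨ cong₂ (λ z w → z + (- t₁ * w + - t₂ * ∑∑ C)) (twisted-sum-vanishes L i j bound-A)
                                                      (twisted-sum-vanishes L (suc i) j bound-B) ⟩
    0# + (- t₁ * 0# + - t₂ * ∑∑ C)
      ≡⟨ cong (λ w → 0# + (- t₁ * 0# + - t₂ * w)) (twisted-sum-vanishes L i (suc j) bound-C) ⟩
    0# + (- t₁ * 0# + - t₂ * 0#)
      ≡⟨ solve 2 (λ a b → :0 :+ (a :* :0 :+ b :* :0) := :0) refl (- t₁) (- t₂) ⟩
    0# ∎
    where
    open ≡-Reasoning
    A B C : Carrier → Carrier → Carrier
    A u v = u ^ i * v ^ j * product L u v
    B u v = u ^ suc i * v ^ j * product L u v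
    C u v = u ^ i * v ^ suc j * product L u v
    bound-B : suc i ℕ.+ j ℕ.+ length L ℕ.< n ℕ.+ n
    bound-B = subst (ℕ._< n ℕ.+ n) (ℕP.+-suc (i ℕ.+ j) (length L)) bound
    bound-A : i ℕ.+ j ℕ.+ length L ℕ.< n ℕ.+ n
    bound-A = ℕP.<-trans (ℕP.n<1+n _) bound-B
    bound-C : i ℕ.+ suc j ℕ.+ length L ℕ.< n ℕ.+ n
    bound-C = subst (λ z → z ℕ.+ length L ℕ.< n ℕ.+ n) (sym (ℕP.+-suc i j)) bound-B

  Blocks : Point → List Point → Set
  Blocks x T = ∀ d c → ¬ c ≡ intercept d x → ∃[ pt ] (pt ∈ T × pt on (d , c))

  module _ (x : Point) (T : List Point) (blocks : Blocks x T) where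
    x₁ = proj₁ x
    x₂ = proj₂ x

    translate : Point → Carrier × Carrier
    translate (a , b) = (a + - x₁ , b + - x₂)

    L = map translate T

    -- for u ≠ 0 the vertical line a = x₁ + u⁻¹ avoids x; a point of T on it kills the form
    vanishes-vertical : ∀ u → ¬ u ≡ 0# → product L u 0# ≡ 0#
    vanishes-vertical u u≢0 with blocks nothing (x₁ + u ⁻¹) avoids-x
      where
      avoids-x : ¬ (x₁ + u ⁻¹) ≡ x₁
      avoids-x e = ⁻¹≢0 u≢0 (trans (solve 2 (λ i x → i := (x :+ i) :- x) refl (u ⁻¹) x₁) (≡⇒difference-zero e))
    ... | (a , b) , ab∈T , refl = product-zero L u 0# (∈-map⁺ translate ab∈T) (begin
      1# + - ((x₁ + u ⁻¹ + - x₁) * u) + - ((b + - x₂) * 0#)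
        ≡⟨ solve 5 (λ x₁ i u b x₂ → :1 :- (x₁ :+ i :- x₁) :* u :- (b :- x₂) :* :0 := :1 :- u :* i) refl x₁ (u ⁻¹) u b x₂ ⟩
      1# + - (u * u ⁻¹) ≡⟨ cong (λ z → 1# + - z) (⁻¹-inverse u u≢0) ⟩
      1# + - 1#         ≡⟨ -‿inverseʳ 1# ⟩
      0#                ∎)
      where open ≡-Reasoning

    -- for v ≠ 0 the line of slope -u/v through (x₁ , x₂ + v⁻¹) avoids x
    vanishes-sloped : ∀ u v → ¬ v ≡ 0# → product L u v ≡ 0#
    vanishes-sloped u v v≢0 with blocks (just slope) c avoids-x
      where
      w = v ⁻¹
      slope = - (u * w)
      c = x₂ + w * (1# + u * x₁)
      avoids-x : ¬ c ≡ x₂ + - (slope * x₁)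
      avoids-x e = ⁻¹≢0 v≢0 (trans (solve 4 (λ u w x₁ x₂ → w := (x₂ :+ w :* (:1 :+ u :* x₁)) :- (x₂ :- (:- (u :* w)) :* x₁))
                                      refl u w x₁ x₂) (≡⇒difference-zero e))
    ... | (a , b) , ab∈T , refl = product-zero L u v (∈-map⁺ translate ab∈T) (begin
      1# + - ((a + - x₁) * u) + - ((- (u * w) * a + (x₂ + w * (1# + u * x₁)) + - x₂) * v)
        ≡⟨ solve 6 (λ a x₁ u v w x₂ → :1 :- (a :- x₁) :* u :- ((:- (u :* w)) :* a :+ (x₂ :+ w :* (:1 :+ u :* x₁)) :- x₂) :* v
                       := (:1 :- v :* w) :* (:1 :- u :* a :+ u :* x₁)) refl a x₁ u v w x₂ ⟩
      (1# + - (v * w)) * (1# + - (u * a) + u * x₁)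
        ≡⟨ cong (λ z → (1# + - z) * (1# + - (u * a) + u * x₁)) (⁻¹-inverse v v≢0) ⟩
      (1# + - 1#) * (1# + - (u * a) + u * x₁)
        ≡⟨ trans (cong (_* (1# + - (u * a) + u * x₁)) (-‿inverseʳ 1#)) (zeroˡ _) ⟩
      0# ∎)
      where
      open ≡-Reasoning
      w = v ⁻¹

    vanishes-off-origin : ∀ u v → ¬ (u ≡ 0# × v ≡ 0#) → product L u v ≡ 0#
    vanishes-off-origin u v not-origin with v ≟ 0#
    ... | yes refl = vanishes-vertical u (λ u≡0 → not-origin (u≡0 , refl))
    ... | no  v≢0  = vanishes-sloped u v v≢0

    product-sum : ∑∑ (λ u v → product L u v) ≡ 1#
    product-sum = begin
      ∑∑ (λ u v → product L u v) ≡⟨ ∑-single (λ u → ∑ (λ v → product L u v)) 0#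
                                      (λ u u≢0 → ∑-zero _ (λ v → vanishes-off-origin u v (λ e → u≢0 (proj₁ e)))) ⟩
      ∑ (λ v → product L 0# v)   ≡⟨ ∑-single (λ v → product L 0# v) 0#
                                      (λ v v≢0 → vanishes-off-origin 0# v (λ e → v≢0 (proj₂ e))) ⟩
      product L 0# 0#            ≡⟨ product-origin L ⟩
      1#                         ∎
      where open ≡-Reasoning

    blocking-bound : n ℕ.+ n ℕ.≤ length T
    blocking-bound = ℕP.≮⇒≥ λ |T|<2n → 0≢1 (begin
      0#
        ≡⟨ sym (twisted-sum-vanishes L 0 0 (subst (ℕ._< n ℕ.+ n) (sym (length-map translate T)) |T|<2n)) ⟩
      ∑∑ (λ u v → u ^ 0 * v ^ 0 * product L u v)
        ≡⟨ ∑∑-cong (λ u v → trans (cong (_* product L u v) (*-identityˡ 1#)) (*-identityˡ _)) ⟩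
      ∑∑ (λ u v → product L u v)
        ≡⟨ product-sum ⟩
      1# ∎)
      where open ≡-Reasoning

module Properties𝒢 (k : ℕ) (F : FiniteField (suc (suc k))) (K : FiniteField (suc k))
  (x : AG.Point F) (d₁ : AG.Dir K)
  (σ : AG.Dir F → (FiniteField.Carrier K ↔ Maybe (Fin k)))
  (τ : (i : AG.Dir F) → (Construction.EdgeC F K x i ↔ Construction.JClass F K d₁)) where

  open Construction F K using (EdgeC; JClass; Vtx; avx; jvx; GEdge; _∈G_; 𝒢; cls)
  open Counting using (disjoint-families-bound; all-or-counterexample)
  module AF = AG F
  module AK = AG K
  module FF = FieldArith F
  module FK = FieldArith K
  module IF = Incidence F
  module IK = Incidence K
  module EF = Elements F
  module EK = Elements K

  Vertex : Set
  Vertex = Vtx x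

  Edge : Set
  Edge = GEdge x d₁ σ τ

  _∈ₑ_ : Vertex → Edge → Set
  v ∈ₑ e = _∈G_ x d₁ σ τ v e

  classOf : (i : AF.Dir) → EdgeC x i → AK.Dir
  classOf i e = proj₁ (Inverse.to (τ i) e)

  classOf-≢d₁ : ∀ i e → ¬ classOf i e ≡ d₁
  classOf-≢d₁ i e = toWitnessFalse (proj₂ (Inverse.to (τ i) e))

  classOf-injective : ∀ i {e e′ : EdgeC x i} → classOf i e ≡ classOf i e′ → e ≡ e′
  classOf-injective i {e} {e′} eq = ↔-injective (τ i) (Σ-≡ eq)
    where
    Σ-≡ : ∀ {J J′ : JClass d₁} → proj₁ J ≡ proj₁ J′ → J ≡ J′
    Σ-≡ {D , h} {.D , h′} refl = cong (D ,_) (T-irrelevant h h′)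

  avx-cong : ∀ {a a′ h h′} → a ≡ a′ → avx {x} a h ≡ avx a′ h′
  avx-cong {a} {h = h} {h′} refl = cong (avx a) (T-irrelevant h h′)

  aPoint : Vertex → Maybe AF.Point
  aPoint (avx a _) = just a
  aPoint (jvx _ _) = nothing

  jvx-injective : ∀ {i j w w′} → jvx {x} i w ≡ jvx j w′ → i ≡ j × w ≡ w′
  jvx-injective refl = refl , refl

  on-edge⇒≢x : ∀ {a i b} → a AF.on (i , b) → ¬ b ≡ AF.intercept i x → ¬ a ≡ x
  on-edge⇒≢x a∈ b≢ refl = b≢ (IF.on⇒intercept a∈)

  on-edge⇒dirOf-≢ : ∀ {a i b} → a AF.on (i , b) → ¬ b ≡ AF.intercept i x → ¬ AF.dirOf x a ≡ i
  on-edge⇒dirOf-≢ {a} a∈ b≢ refl = b≢ (trans (IF.on⇒intercept a∈) (sym (IF.on⇒intercept (IF.dirOf-on x a))))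

  -- Uniformity: an edge e ∪ f consists of the p points of the affine line e
  -- and the p-1 points of the line f of 𝒥^i.
  module EdgeVertices (i : AF.Dir) (b : FF.Carrier) (b≢ : False (b FF.≟ AF.intercept i x)) (c : FK.Carrier) where
    e : EdgeC x i
    e = b , b≢

    aVertex : FF.Carrier → Vertex
    aVertex t = avx (IF.pointAt (i , b) t) (fromWitnessFalse (on-edge⇒≢x (IF.pointAt-on (i , b) t) (toWitnessFalse b≢)))

    jVertex : FK.Carrier → Vertex
    jVertex t = jvx i (IK.pointAt (classOf i e , c) t)

    vertices : List Vertex
    vertices = map aVertex EF.elements ++ map jVertex EK.elements

    vertices-unique : Unique vertices
    vertices-unique = ++⁺ (map⁺ aVertex-injective EF.elements-unique) (map⁺ jVertex-injective EK.elements-unique) disjoint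
      where
      aVertex-injective : ∀ {t t′} → aVertex t ≡ aVertex t′ → t ≡ t′
      aVertex-injective eq = IF.pointAt-injective (i , b) (just-injective (cong aPoint eq))
      jVertex-injective : ∀ {t t′} → jVertex t ≡ jVertex t′ → t ≡ t′
      jVertex-injective eq = IK.pointAt-injective (classOf i e , c) (proj₂ (jvx-injective eq))
      disjoint : ∀ {v} → ¬ (v ∈ map aVertex EF.elements × v ∈ map jVertex EK.elements)
      disjoint (v∈A , v∈J) with ∈-map⁻ aVertex v∈A | ∈-map⁻ jVertex v∈J
      ... | t , _ , refl | t′ , _ , ()

    length-vertices : length vertices ≡ suc (suc k) ℕ.+ suc k
    length-vertices = trans (length-++ (map aVertex EF.elements))
      (cong₂ ℕ._+_ (trans (length-map aVertex EF.elements) (length-tabulate EF.elementAt))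
                   (trans (length-map jVertex EK.elements) (length-tabulate EK.elementAt)))

    vertices-sound : ∀ v → v ∈ vertices → v ∈ₑ (i , e , c)
    vertices-sound v v∈ with ∈-++⁻ (map aVertex EF.elements) v∈
    ... | inj₁ v∈A with ∈-map⁻ aVertex v∈A
    ...   | t , _ , refl = IF.pointAt-on (i , b) t
    vertices-sound v v∈ | inj₂ v∈J with ∈-map⁻ jVertex v∈J
    ...   | t , _ , refl = refl , IK.pointAt-on (classOf i e , c) t

    vertices-complete : ∀ v → v ∈ₑ (i , e , c) → v ∈ vertices
    vertices-complete (avx a h) a∈ with IF.on⇒pointAt a∈
    ... | t , refl = ∈-++⁺ˡ (subst (_∈ map aVertex EF.elements) (avx-cong refl) (∈-map⁺ aVertex (EF.∈-elements t)))
    vertices-complete (jvx j w) (refl , w∈) with IK.on⇒pointAt w∈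
    ... | t , refl = ∈-++⁺ʳ (map aVertex EF.elements) (∈-map⁺ jVertex (EK.∈-elements t))

  uniform : IsUniform (𝒢 x d₁ σ τ) (suc (suc k) ℕ.+ suc k)
  uniform (i , (b , b≢) , c) =
    vertices , vertices-unique , length-vertices , λ v → mk⇔ (vertices-sound v) (vertices-complete v)
    where open EdgeVertices i b b≢ c

  jClass : AF.Dir → Maybe (Fin k) → AF.Dir ⊎ Fin k
  jClass i = maybe inj₂ (inj₁ i)

  jClass-injective : ∀ {i} {X Y : Maybe (Fin k)} → jClass i X ≡ jClass i Y → X ≡ Y
  jClass-injective {X = nothing} {nothing} _    = refl
  jClass-injective {X = nothing} {just _}  ()
  jClass-injective {X = just _}  {nothing} ()
  jClass-injective {X = just _}  {just _}  refl = refl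

  jClass-≢ : ∀ {d i : AF.Dir} (Y : Maybe (Fin k)) → ¬ d ≡ i → ¬ inj₁ d ≡ jClass i Y
  jClass-≢ nothing  d≢i refl = d≢i refl
  jClass-≢ (just _) d≢i ()

  -- Partiteness: two 𝒜_p-vertices of one edge in the same class V_d lie on
  -- the line through x of direction d and on the edge line, which differ in
  -- direction; a 𝒜_p-vertex on an edge of C_i is never in V_i; two
  -- 𝒥^i-vertices in one class lie on the same line of B₁.
  partite : IsPartiteWrt (𝒢 x d₁ σ τ) (cls x d₁ σ τ)
  partite (i , (b , b≢) , c) (avx a _) (avx a′ _) a∈ a′∈ same-class =
    avx-cong (IF.meet-unique (λ i≡ → on-edge⇒dirOf-≢ a∈ (toWitnessFalse b≢) (sym i≡))
                a∈ (IF.dirOf-on x a)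
                a′∈ (subst (λ d → a′ AF.on (d , AF.intercept d x)) (sym (inj₁-injective same-class)) (IF.dirOf-on x a′)))
  partite (i , (b , b≢) , c) (avx a _) (jvx j w) a∈ (refl , _) same-class =
    ⊥-elim (jClass-≢ (Inverse.to (σ i) (AK.intercept d₁ w)) (on-edge⇒dirOf-≢ a∈ (toWitnessFalse b≢)) same-class)
  partite (i , (b , b≢) , c) (jvx j w) (avx a _) (refl , _) a∈ same-class =
    ⊥-elim (jClass-≢ (Inverse.to (σ i) (AK.intercept d₁ w)) (on-edge⇒dirOf-≢ a∈ (toWitnessFalse b≢)) (sym same-class))
  partite (i , e , c) (jvx j w) (jvx j′ w′) (refl , w∈) (refl , w′∈) same-class =
    cong (jvx i) (IK.meet-unique (classOf-≢d₁ i e) w∈ (IK.intercept-on w d₁) w′∈ (IK.intercept⇒on same-B₁-line))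
    where
    same-B₁-line : AK.intercept d₁ w ≡ AK.intercept d₁ w′
    same-B₁-line = ↔-injective (σ i) (jClass-injective same-class)

  -- Intersection: edges from different C_i, C_j meet in 𝒜_p; different
  -- edges of one C_i are assigned different classes of 𝒥^i, whose lines meet.
  intersecting : IsIntersecting (𝒢 x d₁ σ τ)
  intersecting (i , (b , b≢) , c) (i′ , (b′ , b′≢) , c′) with i AF.≟D i′
  ... | no i≢i′ with IF.meet b b′ i≢i′
  ...   | a , a∈ , a∈′ = avx a (fromWitnessFalse (on-edge⇒≢x a∈ (toWitnessFalse b≢))) , a∈ , a∈′
  intersecting (i , (b , b≢) , c) (i , (b′ , b′≢) , c′) | yes refl with b FF.≟ b′
  ... | yes refl = avx a (fromWitnessFalse (on-edge⇒≢x (IF.pointAt-on (i , b) FF.0#) (toWitnessFalse b≢))) ,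
                   IF.pointAt-on (i , b) FF.0# , IF.pointAt-on (i , b) FF.0#
    where a = IF.pointAt (i , b) FF.0#
  ... | no b≢b′ with IK.meet {classOf i (b , b≢)} {classOf i (b′ , b′≢)} c c′
                       (λ eq → b≢b′ (cong proj₁ (classOf-injective i eq)))
  ...   | w , w∈ , w∈′ = jvx i w , (refl , w∈) , (refl , w∈′)

  module Cover (S : List Vertex) (cover : IsCover (𝒢 x d₁ σ τ) S) where

    OnLine : AF.Line → Vertex → Set
    OnLine ℓ (avx a _) = a AF.on ℓ
    OnLine ℓ (jvx _ _) = ⊥

    on-line? : ∀ ℓ v → Dec (OnLine ℓ v)
    on-line? ℓ (avx a _) = IF.on? a ℓ
    on-line? ℓ (jvx _ _) = no (λ ())

    Blocked : AF.Line → Set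
    Blocked ℓ = Any (OnLine ℓ) S

    Missed : AF.Dir → FF.Carrier → Set
    Missed d b = ¬ b ≡ AF.intercept d x × ¬ Blocked (d , b)

    classify-direction : ∀ d → (∀ b → ¬ b ≡ AF.intercept d x → Blocked (d , b)) ⊎ ∃[ b ] Missed d b
    classify-direction d with all-or-counterexample blocked-if-edge? EF.elements
      where
      blocked-if-edge? : ∀ b → Dec (¬ b ≡ AF.intercept d x → Blocked (d , b))
      blocked-if-edge? b with b FF.≟ AF.intercept d x | any? (on-line? (d , b)) S
      ... | yes b≡ | _          = yes (λ b≢ → ⊥-elim (b≢ b≡))
      ... | no  _  | yes bl     = yes (λ _ → bl)
      ... | no  b≢ | no  not-bl = no (λ f → not-bl (f b≢))
    ... | inj₁ all-blocked    = inj₁ (λ b → all-blocked (EF.∈-elements b))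
    ... | inj₂ (b , ¬blocked) =
      inj₂ (b , (λ b≡ → ¬blocked (λ b≢ → ⊥-elim (b≢ b≡))) , (λ bl → ¬blocked (λ _ → bl)))

    directions : List AF.Dir
    directions = nothing ∷ map just EF.elements

    ∈-directions : ∀ d → d ∈ directions
    ∈-directions nothing  = here refl
    ∈-directions (just a) = there (∈-map⁺ just (EF.∈-elements a))

    classify : (∀ d b → ¬ b ≡ AF.intercept d x → Blocked (d , b)) ⊎ ∃[ d ] ∃[ b ] Missed d b
    classify with all-or-counterexample all-blocked? directions
      where
      all-blocked? : ∀ d → Dec (∀ b → ¬ b ≡ AF.intercept d x → Blocked (d , b))
      all-blocked? d with classify-direction d
      ... | inj₁ all-blocked     = yes all-blocked
      ... | inj₂ (b , b≢ , not-bl) = no (λ f → not-bl (f b b≢))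
    ... | inj₁ all-blocked = inj₁ (λ d → all-blocked (∈-directions d))
    ... | inj₂ (d , ¬all-blocked) with classify-direction d
    ...   | inj₁ all-blocked = ⊥-elim (¬all-blocked all-blocked)
    ...   | inj₂ missed      = inj₂ (d , missed)

    -- If every line avoiding x is blocked, the points of S ∩ 𝒜_p form a
    -- blocking set of AG(2,p), so the blocking-set bound applies.
    aPoints : List AF.Point
    aPoints = mapMaybe aPoint S

    avx∈⇒∈aPoints : ∀ {a h} (S′ : List Vertex) → avx a h ∈ S′ → a ∈ mapMaybe aPoint S′
    avx∈⇒∈aPoints (avx _ _ ∷ S′) (here refl) = here refl
    avx∈⇒∈aPoints (avx _ _ ∷ S′) (there a∈)  = there (avx∈⇒∈aPoints S′ a∈)
    avx∈⇒∈aPoints (jvx _ _ ∷ S′) (here ())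
    avx∈⇒∈aPoints (jvx _ _ ∷ S′) (there a∈)  = avx∈⇒∈aPoints S′ a∈

    blocked⇒aPoint : ∀ {ℓ} → Blocked ℓ → ∃[ a ] (a ∈ aPoints × a AF.on ℓ)
    blocked⇒aPoint bl with find bl
    ... | avx a _ , v∈S , a∈ℓ = a , avx∈⇒∈aPoints S v∈S , a∈ℓ

    all-blocked-bound : (∀ d b → ¬ b ≡ AF.intercept d x → Blocked (d , b)) → suc k ℕ.+ suc k ℕ.≤ length S
    all-blocked-bound all-blocked =
      ℕP.≤-trans (BlockingSets.blocking-bound F x aPoints (λ d b b≢ → blocked⇒aPoint (all-blocked d b b≢)))
                 (length-mapMaybe aPoint S)

    -- A missed edge e of C_i forces p-1 vertices of S in 𝒥^i: each of the
    -- p-1 edges e ∪ f, f in the class of 𝒥^i assigned to e, is covered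
    -- inside f, and these lines f are pairwise disjoint.
    record CopyTransversal (i : AF.Dir) : Set where
      field
        point    : Fin (suc k) → AK.Point
        in-cover : ∀ t → jvx i (point t) ∈ S
        distinct : Injective _≡_ _≡_ point

    copy-transversal : ∀ i b → Missed i b → CopyTransversal i
    copy-transversal i b (b≢ , not-blocked) = record
      { point    = λ t → proj₁ (hit t)
      ; in-cover = λ t → proj₁ (proj₂ (hit t))
      ; distinct = λ {t} {t′} eq → EK.elementAt-injective
          (trans (IK.on⇒intercept (proj₂ (proj₂ (hit t))))
                 (trans (cong (AK.intercept D) eq) (sym (IK.on⇒intercept (proj₂ (proj₂ (hit t′)))))))
      }
      where
      e : EdgeC x i
      e = b , fromWitnessFalse b≢
      D = classOf i e
      hit : ∀ t → Σ AK.Point λ w → jvx i w ∈ S × w AK.on (D , EK.elementAt t)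
      hit t with cover (i , e , EK.elementAt t)
      ... | avx a _ , v∈S , a∈        = ⊥-elim (not-blocked (lose v∈S a∈))
      ... | jvx _ w , v∈S , (refl , w∈) = w , v∈S , w∈

    -- If all edges of C_j are blocked, their p-1 blocking vertices are
    -- distinct, since the edges are pairwise disjoint.
    record LineTransversal : Set where
      field
        point    : Fin (suc k) → AF.Point
        off-x    : ∀ t → False (point t AF.≟P x)
        in-cover : ∀ t → avx (point t) (off-x t) ∈ S
        distinct : Injective _≡_ _≡_ point

    line-transversal : ∀ j → (∀ b → ¬ b ≡ AF.intercept j x → Blocked (j , b)) → LineTransversal
    line-transversal j all-blocked = record
      { point    = λ t → proj₁ (hit t)
      ; off-x    = λ t → proj₁ (proj₂ (hit t))
      ; in-cover = λ t → proj₁ (proj₂ (proj₂ (hit t)))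
      ; distinct = λ {t} {t′} eq → EF.except-injective (AF.intercept j x)
          (trans (IF.on⇒intercept (proj₂ (proj₂ (proj₂ (hit t)))))
                 (trans (cong (AF.intercept j) eq) (sym (IF.on⇒intercept (proj₂ (proj₂ (proj₂ (hit t′))))))))
      }
      where
      edge : Fin (suc k) → FF.Carrier
      edge = EF.except (AF.intercept j x)
      hit : ∀ t → Σ AF.Point λ a → Σ (False (a AF.≟P x)) λ h → avx a h ∈ S × a AF.on (j , edge t)
      hit t with find (all-blocked (edge t) (EF.except-≢ _ t))
      ... | avx a h , v∈S , a∈ = a , h , v∈S , a∈

    other : AF.Dir → AF.Dir
    other nothing  = just FF.0#
    other (just _) = nothing

    other-≢ : ∀ i → ¬ other i ≡ i
    other-≢ nothing  ()
    other-≢ (just _) ()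

    -- τ(𝒢_r) ≥ 2p - 2: either all edges of 𝒜_p are blocked, or some edge of
    -- C_i is missed; then C_j (j ≠ i) either is fully blocked or also has a
    -- missed edge, giving two disjoint families of p-1 vertices of S.
    cover-bound : suc k ℕ.+ suc k ℕ.≤ length S
    cover-bound with classify
    ... | inj₁ all-blocked = all-blocked-bound all-blocked
    ... | inj₂ (i , b , missed) with classify-direction (other i)
    ...   | inj₁ all-blocked =
      disjoint-families-bound S (λ t → jvx i (C.point t)) (λ t → avx (L.point t) (L.off-x t))
        (λ eq → C.distinct (proj₂ (jvx-injective eq))) (λ eq → L.distinct (just-injective (cong aPoint eq)))
        (λ s t ()) C.in-cover L.in-cover
      where
      module C = CopyTransversal (copy-transversal i b missed)
      module L = LineTransversal (line-transversal (other i) all-blocked)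
    ...   | inj₂ (b′ , missed′) =
      disjoint-families-bound S (λ t → jvx i (C.point t)) (λ t → jvx (other i) (C′.point t))
        (λ eq → C.distinct (proj₂ (jvx-injective eq))) (λ eq → C′.distinct (proj₂ (jvx-injective eq)))
        (λ s t eq → other-≢ i (sym (proj₁ (jvx-injective eq)))) C.in-cover C′.in-cover
      where
      module C  = CopyTransversal (copy-transversal i b missed)
      module C′ = CopyTransversal (copy-transversal (other i) b′ missed′)

-- ℕ multiplication, imported only here because the fields above use the name _*_
open import Data.Nat using (_*_)

field-order : ∀ {q} → FiniteField q → ∃[ n ] q ≡ suc (suc n)
field-order {zero} F with Inverse.from (FiniteField.card F) (FiniteField.0# F)
... | ()
field-order {suc zero} F = ⊥-elim (0≢1 (↔-injective (↔-sym card) (only-index _ _)))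
  where
  open FiniteField F
  only-index : (i j : Fin 1) → i ≡ j
  only-index Fin.zero Fin.zero = refl
field-order {suc (suc n)} F = n , refl

-- r = 2p - 1 and r - 1 = 2(p - 1), written for p = k + 2
rank : ∀ k → 2 ℕ.* suc (suc k) ∸ 1 ≡ suc (suc k) ℕ.+ suc k
rank k = cong suc (trans (cong (k ℕ.+_) (ℕP.+-identityʳ (suc (suc k)))) (ℕP.+-suc k (suc k)))

rank-1 : ∀ k → 2 ℕ.* suc (suc k) ∸ 1 ∸ 1 ≡ suc k ℕ.+ suc k
rank-1 k = cong (_∸ 1) (rank k)

theorem7 : (p : ℕ) → IsPrimePower p → IsPrimePower (p ∸ 1)
  → (F : FiniteField p) → (K : FiniteField (p ∸ 1))
  → (x : AG.Point F) → (d₁ : AG.Dir K)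
  → (σ : AG.Dir F → (FiniteField.Carrier K ↔ Maybe (Fin (p ∸ 2))))
  → (τ : (i : AG.Dir F) → (Construction.EdgeC F K x i ↔ Construction.JClass F K d₁))
  → let G = Construction.𝒢 F K x d₁ σ τ
        r = 2 * p ∸ 1
    in (IsUniform G r × IsPartiteWrt G (Construction.cls F K x d₁ σ τ) × IsIntersecting G)
       × τ≥ G (r ∸ 1)
theorem7 p _ _ F K x d₁ σ τ with field-order F
... | k , refl =
  (subst (IsUniform G) (sym (rank k)) uniform , partite , intersecting) ,
  λ S _ cover → subst (ℕ._≤ length S) (sym (rank-1 k)) (Cover.cover-bound S cover)
  where
  open Properties𝒢 k F K x d₁ σ τ
  G = Construction.𝒢 F K x d₁ σ τ
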